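{- Let $k\ge 2$. For every binary sequence $\alpha_1,\dots,\alpha_{k-1}\in\{0,1\}$ there are induced subgraphs $Y_1,\dots,Y_{k-1}$ of $X_k$, where $Y_i$ is isomorphic to $X_i$ (as a rooted graph, with a designated root), such that the vertex sets of $Y_1,\dots,Y_{k-1}$ are pairwise disjoint, there are no edges of $X_k$ between distinct $Y_i$ and $Y_{i'}$, and for every $i\in\{1,\dots,k-1\}$: if $\alpha_i=1$ then the root side of $Y_i$ is contained in the root side of $X_k$, and if $\alpha_i=0$ then the non-root side of $Y_i$ is contained in the root side of $X_k$.
   Context: A connected bipartite graph has a unique partition of its vertices into two independent sets, called its sides. The rooted graphs $X_k$ ($k\ge1$) are defined recursively: $X_1$ is a single vertex, which is the root; $X_2$ is a single edge with one of its endpoints as root; for $k\ge3$, $X_k$ consists of two disjoint copies $X^1_{k-1}$, $X^2_{k-1}$ of $X_{k-1}$ with no edges between them, plus one new vertex $v$ adjacent to all vertices of the root side of $X^1_{k-1}$ and to all vertices of the non-root side of $X^2_{k-1}$; $v$ is the root of $X_k$. The root side of $X_k$ is the side containing its root; the other side is the non-root side. -}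

module Defs where

open import Data.Nat using (ℕ; zero; suc; _+_; _*_)
open import Data.Fin using (Fin; zero; suc; splitAt)
open import Data.Bool using (Bool; true; false; not)
open import Data.Sum using (inj₁; inj₂; [_,_])
open import Data.Product using (∃-syntax)
open import Relation.Binary.PropositionalEquality using (_≡_)

-- The graphs X_k, indexed by k ≥ 1 (index 0 is a dummy empty graph).  For k ≥ 3, vertex 'zero' is the new
-- root v, vertices 'suc x' with x in the left block of splitAt are copy
-- X¹_{k-1}, those in the right block are copy X²_{k-1}.

size : ℕ → ℕ
size zero = zero
size (suc zero) = 1
size (suc (suc zero)) = 2
size (suc (suc (suc j))) = suc (size (suc (suc j)) + size (suc (suc j)))

root : (k : ℕ) → Fin (size (suc k))
root zero = zero
root (suc zero) = zero
root (suc (suc j)) = zero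

glue : {A : Set} (m : ℕ) → A → (Fin m → A) → (Fin m → A) → Fin (suc (m + m)) → A
glue m r f g zero = r
glue m r f g (suc x) = [ f , g ] (splitAt m x)

glue₂ : (m : ℕ) → (Fin m → Fin m → Bool) → Fin (m + m) → Fin (m + m) → Bool
glue₂ m e x y with splitAt m x | splitAt m y
... | inj₁ a | inj₁ a' = e a a'
... | inj₂ b | inj₂ b' = e b b'
... | inj₁ _ | inj₂ _ = false
... | inj₂ _ | inj₁ _ = false

-- Auxiliary side labelling used only to *build* X_k (true = root side of
-- X_k); the statement itself uses the walk-parity notion of side below.
side : (k : ℕ) → Fin (size k) → Bool
side zero ()
side (suc zero) _ = true
side (suc (suc zero)) zero = true
side (suc (suc zero)) (suc _) = false
side (suc k@(suc (suc j))) = glue (size k) true (λ a → not (side k a)) (side k)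

-- Adjacency of X_k.  v is adjacent to the root side of X¹_{k-1} and to the
-- non-root side of X²_{k-1}.
adj : (k : ℕ) → Fin (size k) → Fin (size k) → Bool
adj zero () _
adj (suc zero) _ _ = false
adj (suc (suc zero)) zero zero = false
adj (suc (suc zero)) zero (suc _) = true
adj (suc (suc zero)) (suc _) zero = true
adj (suc (suc zero)) (suc _) (suc _) = false
adj (suc k@(suc (suc j))) zero = glue (size k) false (side k) (λ b → not (side k b))
adj (suc k@(suc (suc j))) (suc x) zero =
  glue (size k) false (side k) (λ b → not (side k b)) (suc x)
adj (suc k@(suc (suc j))) (suc x) (suc y) = glue₂ (size k) (adj k) x y

data Walk (k : ℕ) : Fin (size k) → Fin (size k) → ℕ → Set where
  here : ∀ {u} → Walk k u u zero
  step : ∀ {u w x n} → adj k u w ≡ true → Walk k w x n → Walk k u x (suc n)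

RootSide : (k : ℕ) → Fin (size (suc k)) → Set
RootSide k u = ∃[ m ] Walk (suc k) (root k) u (m * 2)

NonRootSide : (k : ℕ) → Fin (size (suc k)) → Set
NonRootSide k u = ∃[ m ] Walk (suc k) (root k) u (suc (m * 2))

{-# OPTIONS --safe #-}
-- X_(j+3) consists of an apex and two disjoint, mutually non-adjacent induced copies
-- of X_(j+2). The apex is adjacent to the root of the first copy and at distance 2
-- from the root of the second, so the first copy swaps the two sides of X_(j+3) and
-- the second keeps them. Hence Y_(k-1) can be taken to be the copy that puts its
-- root on the side prescribed by α_(k-1), and Y_1, ..., Y_(k-2) are placed
-- recursively inside the other copy, with the remaining α's complemented when that
-- copy swaps sides. Induced embeddings carry walks to walks, so the side of every
-- vertex of a piece is fixed by the side of the piece's root.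
module Submission where

open import Defs
open import Data.Nat using (ℕ; zero; suc; _+_; _*_; _≤_; _∸_; _≤′_; ≤′-refl; ≤′-step; s≤s)
open import Data.Nat.Properties using (+-suc; *-distribʳ-+; ≤⇒≤′)
open import Data.Fin using (Fin; zero; suc; toℕ; _↑ˡ_; _↑ʳ_; splitAt)
open import Data.Fin.Properties using (toℕ≤pred[n]; toℕ-injective; suc-injective; ↑ˡ-injective; ↑ʳ-injective; splitAt-↑ˡ; splitAt-↑ʳ)
open import Data.Bool using (Bool; true; false; not; _xor_)
open import Data.Product using (Σ; _×_; _,_; proj₁; proj₂)
open import Data.Empty using (⊥-elim)
open import Function using (_∘_)
open import Function.Definitions using (Injective)
open import Relation.Binary.PropositionalEquality using (_≡_; _≢_; refl; sym; trans; cong; subst)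

record _↪_ (a b : ℕ) : Set where
  field
    to : Fin (size a) → Fin (size b)
    injective : Injective _≡_ _≡_ to
    preserves-adj : ∀ x y → adj b (to x) (to y) ≡ adj a x y

open _↪_

_∘↪_ : ∀ {a b c} → b ↪ c → a ↪ b → a ↪ c
g ∘↪ f = record
  { to = to g ∘ to f
  ; injective = injective f ∘ injective g
  ; preserves-adj = λ x y → trans (preserves-adj g _ _) (preserves-adj f x y)
  }

Apart : ∀ {m n} c → (Fin m → Fin (size c)) → (Fin n → Fin (size c)) → Set
Apart c f g = ∀ x y → f x ≢ g y × adj c (f x) (g y) ≡ false

apart-∘ : ∀ {m n b c} {f : Fin m → Fin (size b)} {g : Fin n → Fin (size b)} →
          (h : b ↪ c) → Apart b f g → Apart c (to h ∘ f) (to h ∘ g)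
apart-∘ h f∥g x y =
  (proj₁ (f∥g x y) ∘ injective h) , trans (preserves-adj h _ _) (proj₂ (f∥g x y))

map-walk : ∀ {a b u v n} (f : a ↪ b) → Walk a u v n → Walk b (to f u) (to f v) n
map-walk f here = here
map-walk f (step e w) = step (trans (preserves-adj f _ _) e) (map-walk f w)

_++ʷ_ : ∀ {k u v w m n} → Walk k u v m → Walk k v w n → Walk k u w (m + n)
here ++ʷ w′ = w′
step e w ++ʷ w′ = step e (w ++ʷ w′)

OnSide : (k : ℕ) → Bool → Fin (size (suc k)) → Set
OnSide k true = RootSide k
OnSide k false = NonRootSide k

even+even : ∀ m n → m * 2 + n * 2 ≡ (m + n) * 2
even+even m n = sym (*-distribʳ-+ 2 m n)

even+odd : ∀ m n → m * 2 + suc (n * 2) ≡ suc ((m + n) * 2)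
even+odd m n = trans (+-suc (m * 2) (n * 2)) (cong suc (even+even m n))

concat : ∀ {k u v w m n l} → Walk k u v m → Walk k v w n → m + n ≡ l → Walk k u w l
concat w w′ refl = w ++ʷ w′

extend-even : ∀ {k t u v n} → OnSide k t u → Walk (suc k) u v (n * 2) → OnSide k t v
extend-even {t = true} {n = n} (m , w) w′ = m + n , concat w w′ (even+even m n)
extend-even {t = false} {n = n} (m , w) w′ = m + n , concat w w′ (cong suc (even+even m n))

extend-odd : ∀ {k t u v n} → OnSide k t u → Walk (suc k) u v (suc (n * 2)) → OnSide k (not t) v
extend-odd {t = true} {n = n} (m , w) w′ = m + n , concat w w′ (even+odd m n)
extend-odd {t = false} {n = n} (m , w) w′ = suc (m + n) , concat w w′ (cong suc (even+odd m n))

module _ {a b t} (f : suc a ↪ suc b) (root-on-t : OnSide b t (to f (root a))) where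

  embed-rootSide : ∀ {x} → RootSide a x → OnSide b t (to f x)
  embed-rootSide (n , w) = extend-even {t = t} {n = n} root-on-t (map-walk f w)

  embed-nonRootSide : ∀ {x} → NonRootSide a x → OnSide b (not t) (to f x)
  embed-nonRootSide (n , w) = extend-odd {t = t} {n = n} root-on-t (map-walk f w)

↑ˡ≢↑ʳ : ∀ {m} n (x : Fin m) (y : Fin n) → x ↑ˡ n ≢ m ↑ʳ y
↑ˡ≢↑ʳ {m} n x y x≡y
  with trans (sym (splitAt-↑ˡ m x n)) (trans (cong (splitAt m) x≡y) (splitAt-↑ʳ m n y))
... | ()

module _ {j : ℕ} where

  private
    n : ℕ
    n = size (suc (suc j))

  copy₁ : suc (suc j) ↪ suc (suc (suc j))
  copy₁ = record
    { to = λ x → suc (x ↑ˡ n)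
    ; injective = ↑ˡ-injective n _ _ ∘ suc-injective
    ; preserves-adj = adj-↑ˡ
    }
    where
    adj-↑ˡ : ∀ x y → adj (suc (suc (suc j))) (suc (x ↑ˡ n)) (suc (y ↑ˡ n)) ≡ adj (suc (suc j)) x y
    adj-↑ˡ x y rewrite splitAt-↑ˡ n x n | splitAt-↑ˡ n y n = refl

  copy₂ : suc (suc j) ↪ suc (suc (suc j))
  copy₂ = record
    { to = λ y → suc (n ↑ʳ y)
    ; injective = ↑ʳ-injective n _ _ ∘ suc-injective
    ; preserves-adj = adj-↑ʳ
    }
    where
    adj-↑ʳ : ∀ x y → adj (suc (suc (suc j))) (suc (n ↑ʳ x)) (suc (n ↑ʳ y)) ≡ adj (suc (suc j)) x y
    adj-↑ʳ x y rewrite splitAt-↑ʳ n n x | splitAt-↑ʳ n n y = refl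

  copy₁-copy₂-apart : Apart (suc (suc (suc j))) (to copy₁) (to copy₂)
  copy₁-copy₂-apart x y = ↑ˡ≢↑ʳ n x y ∘ suc-injective , no-edge
    where
    no-edge : adj (suc (suc (suc j))) (to copy₁ x) (to copy₂ y) ≡ false
    no-edge rewrite splitAt-↑ˡ n x n | splitAt-↑ʳ n n y = refl

  copy₂-copy₁-apart : Apart (suc (suc (suc j))) (to copy₂) (to copy₁)
  copy₂-copy₁-apart x y = (λ e → ↑ˡ≢↑ʳ n y x (suc-injective (sym e))) , no-edge
    where
    no-edge : adj (suc (suc (suc j))) (to copy₂ x) (to copy₁ y) ≡ false
    no-edge rewrite splitAt-↑ʳ n n x | splitAt-↑ˡ n y n = refl

  adj-apex-copy₁ : ∀ x → adj (suc (suc (suc j))) zero (to copy₁ x) ≡ side (suc (suc j)) x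
  adj-apex-copy₁ x rewrite splitAt-↑ˡ n x n = refl

  adj-apex-copy₂ : ∀ y → adj (suc (suc (suc j))) zero (to copy₂ y) ≡ not (side (suc (suc j)) y)
  adj-apex-copy₂ y rewrite splitAt-↑ʳ n n y = refl

  side-copy₁ : ∀ x → side (suc (suc (suc j))) (to copy₁ x) ≡ not (side (suc (suc j)) x)
  side-copy₁ x rewrite splitAt-↑ˡ n x n = refl

side-root : ∀ j → side (suc (suc j)) (root (suc j)) ≡ true
side-root zero = refl
side-root (suc j) = refl

rootNeighbour : ∀ j → Fin (size (suc (suc j)))
rootNeighbour zero = suc zero
rootNeighbour (suc j) = to copy₁ (root (suc j))

adj-rootNeighbour : ∀ j → adj (suc (suc j)) (rootNeighbour j) (root (suc j)) ≡ true
adj-rootNeighbour zero = refl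
adj-rootNeighbour (suc j) = trans (adj-apex-copy₁ (root (suc j))) (side-root j)

side-rootNeighbour : ∀ j → side (suc (suc j)) (rootNeighbour j) ≡ false
side-rootNeighbour zero = refl
side-rootNeighbour (suc j) = trans (side-copy₁ (root (suc j))) (cong not (side-root j))

copy : ∀ {j} → Bool → suc (suc j) ↪ suc (suc (suc j))
copy true = copy₂
copy false = copy₁

copy-root-side : ∀ {j} b → OnSide (suc (suc j)) b (to (copy b) (root (suc j)))
copy-root-side {j} true =
  1 , step (trans (adj-apex-copy₂ (rootNeighbour j)) (cong not (side-rootNeighbour j)))
           (step (trans (preserves-adj (copy₂ {j}) _ _) (adj-rootNeighbour j)) here)
copy-root-side {j} false = 0 , step (trans (adj-apex-copy₁ (root (suc j))) (side-root j)) here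

copy-side : ∀ {j x} b s → OnSide (suc j) (b xor s) x → OnSide (suc (suc j)) s (to (copy (not b)) x)
copy-side {j} true true = embed-nonRootSide {t = false} copy₁ (copy-root-side {j} false)
copy-side {j} true false = embed-rootSide {t = false} copy₁ (copy-root-side {j} false)
copy-side {j} false true = embed-rootSide {t = true} copy₂ (copy-root-side {j} true)
copy-side {j} false false = embed-nonRootSide {t = true} copy₂ (copy-root-side {j} true)

copies-apart : ∀ {j} b → Apart (suc (suc (suc j))) (to (copy {j} b)) (to (copy {j} (not b)))
copies-apart {j} true = copy₂-copy₁-apart {j}
copies-apart {j} false = copy₁-copy₂-apart {j}

copies-apart′ : ∀ {j} b → Apart (suc (suc (suc j))) (to (copy {j} (not b))) (to (copy {j} b))
copies-apart′ {j} true = copy₁-copy₂-apart {j}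
copies-apart′ {j} false = copy₂-copy₁-apart {j}

endpoint : Bool → 1 ↪ 2
endpoint true = record
  { to = λ _ → zero
  ; injective = λ { {zero} {zero} _ → refl }
  ; preserves-adj = λ _ _ → refl
  }
endpoint false = record
  { to = λ _ → suc zero
  ; injective = λ { {zero} {zero} _ → refl }
  ; preserves-adj = λ _ _ → refl
  }

endpoint-root-side : ∀ b → OnSide 1 b (to (endpoint b) zero)
endpoint-root-side true = 0 , here
endpoint-root-side false = 0 , step refl here

-- Y α p is the paper's Y_(i+1) inside X_(m+2), with α i playing the role of α_(i+1).
Y : ∀ {i m} → (ℕ → Bool) → i ≤′ m → suc i ↪ suc (suc m)
Y {m = zero} α ≤′-refl = endpoint (α zero)
Y {m = suc j} α ≤′-refl = copy (α (suc j))
Y {m = suc j} α (≤′-step p) = copy (not (α (suc j))) ∘↪ Y ((α (suc j) xor_) ∘ α) p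

Y-root-side : ∀ {i m} α (p : i ≤′ m) → OnSide (suc m) (α i) (to (Y α p) (root i))
Y-root-side {m = zero} α ≤′-refl = endpoint-root-side (α zero)
Y-root-side {m = suc j} α ≤′-refl = copy-root-side (α (suc j))
Y-root-side {i} {suc j} α (≤′-step p) =
  copy-side {j} (α (suc j)) (α i) (Y-root-side ((α (suc j) xor_) ∘ α) p)

Y-apart : ∀ {i i′ m} α (p : i ≤′ m) (q : i′ ≤′ m) → i ≢ i′ →
          Apart (suc (suc m)) (to (Y α p)) (to (Y α q))
Y-apart α ≤′-refl ≤′-refl i≢i′ = ⊥-elim (i≢i′ refl)
Y-apart {m = suc j} α ≤′-refl (≤′-step q) _ x y = copies-apart (α (suc j)) x (to (Y _ q) y)
Y-apart {m = suc j} α (≤′-step p) ≤′-refl _ x y = copies-apart′ (α (suc j)) (to (Y _ p) x) y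
Y-apart {m = suc j} α (≤′-step p) (≤′-step q) i≢i′ =
  apart-∘ (copy (not (α (suc j)))) (Y-apart _ p q i≢i′)

-- Beyond n the value false is junk: Y only reads α at indices below n.
atℕ : ∀ {n} → (Fin n → Bool) → ℕ → Bool
atℕ {zero} α _ = false
atℕ {suc n} α zero = α zero
atℕ {suc n} α (suc t) = atℕ (α ∘ suc) t

atℕ-toℕ : ∀ {n} (α : Fin n → Bool) i → atℕ α (toℕ i) ≡ α i
atℕ-toℕ α zero = refl
atℕ-toℕ α (suc i) = atℕ-toℕ (α ∘ suc) i

claim2 : (k : ℕ) → 2 ≤ k → (α : Fin (k ∸ 1) → Bool) →
    Σ ((i : Fin (k ∸ 1)) → Fin (size (suc (toℕ i))) → Fin (size (suc (k ∸ 1)))) λ Y →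
      ((i : Fin (k ∸ 1)) → Injective _≡_ _≡_ (Y i))
      × ((i : Fin (k ∸ 1)) → (a b : Fin (size (suc (toℕ i)))) →
           adj (suc (k ∸ 1)) (Y i a) (Y i b) ≡ adj (suc (toℕ i)) a b)
      × ((i i′ : Fin (k ∸ 1)) → i ≢ i′ → (a : Fin (size (suc (toℕ i)))) →
           (b : Fin (size (suc (toℕ i′)))) → Y i a ≢ Y i′ b)
      × ((i i′ : Fin (k ∸ 1)) → i ≢ i′ → (a : Fin (size (suc (toℕ i)))) →
           (b : Fin (size (suc (toℕ i′)))) → adj (suc (k ∸ 1)) (Y i a) (Y i′ b) ≡ false)
      × ((i : Fin (k ∸ 1)) →
           (α i ≡ true → (a : Fin (size (suc (toℕ i)))) →
              RootSide (toℕ i) a → RootSide (k ∸ 1) (Y i a))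
           × (α i ≡ false → (a : Fin (size (suc (toℕ i)))) →
              NonRootSide (toℕ i) a → RootSide (k ∸ 1) (Y i a)))
claim2 (suc (suc m)) (s≤s (s≤s _)) α =
    to ∘ Yᵢ
  , injective ∘ Yᵢ
  , preserves-adj ∘ Yᵢ
  , (λ i i′ i≢i′ a b → proj₁ (apart i i′ i≢i′ a b))
  , (λ i i′ i≢i′ a b → proj₂ (apart i i′ i≢i′ a b))
  , λ i → (λ αᵢ≡true _ → embed-rootSide {t = true} (Yᵢ i) (root-on i αᵢ≡true))
        , (λ αᵢ≡false _ → embed-nonRootSide {t = false} (Yᵢ i) (root-on i αᵢ≡false))
  where
  bound : (i : Fin (suc m)) → toℕ i ≤′ m
  bound i = ≤⇒≤′ (toℕ≤pred[n] i)

  Yᵢ : (i : Fin (suc m)) → suc (toℕ i) ↪ suc (suc m)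
  Yᵢ i = Y (atℕ α) (bound i)

  apart : ∀ i i′ → i ≢ i′ → Apart (suc (suc m)) (to (Yᵢ i)) (to (Yᵢ i′))
  apart i i′ i≢i′ = Y-apart (atℕ α) (bound i) (bound i′) (i≢i′ ∘ toℕ-injective)

  root-on : ∀ i {b} → α i ≡ b → OnSide (suc m) b (to (Yᵢ i) (root (toℕ i)))
  root-on i αᵢ≡b =
    subst (λ b → OnSide (suc m) b _) (trans (atℕ-toℕ α i) αᵢ≡b) (Y-root-side (atℕ α) (bound i))
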